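{- Let $\mathcal C$ be a resource category and $A,B$ objects. (1) For every finite multiset $\mathbf f$ of pointed morphisms $A\to B$: (a) $\delta_B\circ\Pi\mathbf f=\big(\sum_{\mathbf f\lhd\mathbf f_1*\mathbf f_2}\Pi\mathbf f_1\otimes\Pi\mathbf f_2\big)\circ\delta_A$; (b) $\epsilon_B\circ\Pi\mathbf f=1$ if $\mathbf f$ is empty and $0$ otherwise. (2) For every finite multiset $\mathbf f$ of co-pointed morphisms $A\to B$: (a) $\Pi\mathbf f\circ\mu_A=\mu_B\circ\big(\sum_{\mathbf f\lhd\mathbf f_1*\mathbf f_2}\Pi\mathbf f_1\otimes\Pi\mathbf f_2\big)$; (b) $\Pi\mathbf f\circ\eta_A=1$ if $\mathbf f$ is empty and $0$ otherwise.
   Context: An additive symmetric monoidal category is a symmetric monoidal category $(\otimes,I,\alpha,\lambda,\rho,\gamma)$ whose hom-sets are commutative monoids $(+,0)$ such that composition and $\otimes$ preserve sums and $0$ in each argument. A bialgebra on $A$ consists of $\delta_A:A\to A\otimes A$, $\epsilon_A:A\to I$, $\mu_A:A\otimes A\to A$, $\eta_A:I\to A$ such that $(A,\mu_A,\eta_A)$ is a commutative monoid, $(A,\delta_A,\epsilon_A)$ a commutative comonoid, and (up to structural isomorphisms) $\delta_A\circ\mu_A=(\mu_A\otimes\mu_A)\circ(A\otimes\gamma_{A,A}\otimes A)\circ(\delta_A\otimes\delta_A)$, $\delta_A\circ\eta_A=\eta_A\otimes\eta_A$, $\epsilon_A\circ\mu_A=\epsilon_A\otimes\epsilon_A$, $\epsilon_A\circ\eta_A=\mathrm{id}_I$.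 A pointed identity on $A$ is an idempotent $\mathrm{id}^\bullet_A:A\to A$ with, up to unitors, $\delta_A\circ\mathrm{id}^\bullet_A=\mathrm{id}^\bullet_A\otimes\eta_A+\eta_A\otimes\mathrm{id}^\bullet_A$, $\mathrm{id}^\bullet_A\circ\mu_A=\mathrm{id}^\bullet_A\otimes\epsilon_A+\epsilon_A\otimes\mathrm{id}^\bullet_A$, $\epsilon_A\circ\mathrm{id}^\bullet_A=0$, $\mathrm{id}^\bullet_A\circ\eta_A=0$. A resource category is an additive symmetric monoidal category in which every object carries a bialgebra structure and a pointed identity, compatible with the monoidal structure: up to associativity isomorphisms $\delta_{A\otimes B}=(A\otimes\gamma_{A,B}\otimes B)\circ(\delta_A\otimes\delta_B)$, $\epsilon_{A\otimes B}=\lambda_I\circ(\epsilon_A\otimes\epsilon_B)$, $\epsilon_I=\mathrm{id}_I$, $\mu_{A\otimes B}=(\mu_A\otimes\mu_B)\circ(A\otimes\gamma_{B,A}\otimes B)$, $\eta_{A\otimes B}=(\eta_A\otimes\eta_B)\circ\lambda_I^{ -1}$, $\eta_I=\mathrm{id}_I$. Notation: for objects $X,Y$, $1=\eta_Y\circ\epsilon_X\in\mathcal C(X,Y)$; for $f,g\in\mathcal C(X,Y)$, $f*g=\mu_Y\circ(f\otimes g)\circ\delta_X$; for a finite multiset $\mathbf f=[f_1,\dots,f_n]$, $\Pi\mathbf f=f_1*\cdots*f_n$ (and $\Pi[\,]=1$). A morphism $f:A\to B$ is pointed if $\mathrm{id}^\bullet_B\circ f=f$ and co-pointed if $f\circ\mathrm{id}^\bullet_A=f$.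 For a multiset $\mathbf f$ enumerated as $(f_1,\dots,f_n)$, $\sum_{\mathbf f\lhd\mathbf f_1*\mathbf f_2}F(\mathbf f_1,\mathbf f_2)$ denotes the sum over all functions $p:\{1..n\}\to\{1,2\}$ of $F(\mathbf f_1,\mathbf f_2)$ with $\mathbf f_i=[f_j\mid p(j)=i]$ (independent of the enumeration). -}

module Defs where

open import Level using (Level; suc; _⊔_)
open import Data.List using (List; []; _∷_; foldr; concatMap)
open import Data.Product using (_×_; _,_)
open import Relation.Binary using (Rel; IsEquivalence)

record ResourceCategory (o ℓ e : Level) : Set (suc (o ⊔ ℓ ⊔ e)) where
  infixr 9 _∘_
  infixr 10 _⊗₀_ _⊗₁_
  infixl 6 _+_
  infix 4 _≈_
  field
    Obj : Set o
    Hom : Obj → Obj → Set ℓ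
    _≈_ : ∀ {A B} → Rel (Hom A B) e
    ≈-equiv : ∀ {A B} → IsEquivalence (_≈_ {A} {B})
    id : ∀ {A} → Hom A A
    _∘_ : ∀ {A B C} → Hom B C → Hom A B → Hom A C
    ∘-resp-≈ : ∀ {A B C} {f f' : Hom B C} {g g' : Hom A B} →
               f ≈ f' → g ≈ g' → f ∘ g ≈ f' ∘ g'
    assoc : ∀ {A B C D} {f : Hom A B} {g : Hom B C} {h : Hom C D} →
            (h ∘ g) ∘ f ≈ h ∘ (g ∘ f)
    identityˡ : ∀ {A B} {f : Hom A B} → id ∘ f ≈ f
    identityʳ : ∀ {A B} {f : Hom A B} → f ∘ id ≈ f

    _+_ : ∀ {A B} → Hom A B → Hom A B → Hom A B
    0# : ∀ {A B} → Hom A B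
    +-resp-≈ : ∀ {A B} {f f' g g' : Hom A B} → f ≈ f' → g ≈ g' → f + g ≈ f' + g'
    +-assoc : ∀ {A B} {f g h : Hom A B} → (f + g) + h ≈ f + (g + h)
    +-comm : ∀ {A B} {f g : Hom A B} → f + g ≈ g + f
    +-identityˡ : ∀ {A B} {f : Hom A B} → 0# + f ≈ f

    I : Obj
    _⊗₀_ : Obj → Obj → Obj
    _⊗₁_ : ∀ {A B C D} → Hom A B → Hom C D → Hom (A ⊗₀ C) (B ⊗₀ D)
    ⊗-resp-≈ : ∀ {A B C D} {f f' : Hom A B} {g g' : Hom C D} →
               f ≈ f' → g ≈ g' → f ⊗₁ g ≈ f' ⊗₁ g'
    ⊗-identity : ∀ {A C} → id {A} ⊗₁ id {C} ≈ id
    ⊗-homomorphism : ∀ {A B C D E F} {f : Hom A B} {g : Hom B C}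
                       {h : Hom D E} {k : Hom E F} →
                     (g ∘ f) ⊗₁ (k ∘ h) ≈ (g ⊗₁ k) ∘ (f ⊗₁ h)

    ∘-distribˡ-+ : ∀ {A B C} {h : Hom B C} {f g : Hom A B} → h ∘ (f + g) ≈ h ∘ f + h ∘ g
    ∘-distribʳ-+ : ∀ {A B C} {f g : Hom B C} {h : Hom A B} → (f + g) ∘ h ≈ f ∘ h + g ∘ h
    ∘-zeroˡ : ∀ {A B C} {f : Hom A B} → 0# {B} {C} ∘ f ≈ 0#
    ∘-zeroʳ : ∀ {A B C} {f : Hom B C} → f ∘ 0# {A} {B} ≈ 0#
    ⊗-distribˡ-+ : ∀ {A B C D} {h : Hom C D} {f g : Hom A B} → h ⊗₁ (f + g) ≈ h ⊗₁ f + h ⊗₁ g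
    ⊗-distribʳ-+ : ∀ {A B C D} {f g : Hom A B} {h : Hom C D} → (f + g) ⊗₁ h ≈ f ⊗₁ h + g ⊗₁ h
    ⊗-zeroˡ : ∀ {A B C D} {f : Hom C D} → 0# {A} {B} ⊗₁ f ≈ 0#
    ⊗-zeroʳ : ∀ {A B C D} {f : Hom A B} → f ⊗₁ 0# {C} {D} ≈ 0#

    α⇒ : ∀ {A B C} → Hom ((A ⊗₀ B) ⊗₀ C) (A ⊗₀ (B ⊗₀ C))
    α⇐ : ∀ {A B C} → Hom (A ⊗₀ (B ⊗₀ C)) ((A ⊗₀ B) ⊗₀ C)
    λ⇒ : ∀ {A} → Hom (I ⊗₀ A) A
    λ⇐ : ∀ {A} → Hom A (I ⊗₀ A)
    ρ⇒ : ∀ {A} → Hom (A ⊗₀ I) A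
    ρ⇐ : ∀ {A} → Hom A (A ⊗₀ I)
    γ : ∀ {A B} → Hom (A ⊗₀ B) (B ⊗₀ A)
    α-isoˡ : ∀ {A B C} → α⇐ {A} {B} {C} ∘ α⇒ ≈ id
    α-isoʳ : ∀ {A B C} → α⇒ {A} {B} {C} ∘ α⇐ ≈ id
    λ-isoˡ : ∀ {A} → λ⇐ {A} ∘ λ⇒ ≈ id
    λ-isoʳ : ∀ {A} → λ⇒ {A} ∘ λ⇐ ≈ id
    ρ-isoˡ : ∀ {A} → ρ⇐ {A} ∘ ρ⇒ ≈ id
    ρ-isoʳ : ∀ {A} → ρ⇒ {A} ∘ ρ⇐ ≈ id
    γ-involutive : ∀ {A B} → γ {B} {A} ∘ γ {A} {B} ≈ id
    α-natural : ∀ {A A' B B' C C'} {f : Hom A A'} {g : Hom B B'} {h : Hom C C'} →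
                α⇒ ∘ ((f ⊗₁ g) ⊗₁ h) ≈ (f ⊗₁ (g ⊗₁ h)) ∘ α⇒
    λ-natural : ∀ {A B} {f : Hom A B} → λ⇒ ∘ (id ⊗₁ f) ≈ f ∘ λ⇒
    ρ-natural : ∀ {A B} {f : Hom A B} → ρ⇒ ∘ (f ⊗₁ id) ≈ f ∘ ρ⇒
    γ-natural : ∀ {A A' B B'} {f : Hom A A'} {g : Hom B B'} →
                γ ∘ (f ⊗₁ g) ≈ (g ⊗₁ f) ∘ γ
    pentagon : ∀ {A B C D} →
               (id {A} ⊗₁ α⇒ {B} {C} {D}) ∘ α⇒ ∘ (α⇒ ⊗₁ id) ≈ α⇒ ∘ α⇒
    triangle : ∀ {A B} → (id {A} ⊗₁ λ⇒ {B}) ∘ α⇒ ≈ ρ⇒ ⊗₁ id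
    hexagon : ∀ {A B C} →
              (id {B} ⊗₁ γ {A} {C}) ∘ α⇒ ∘ (γ ⊗₁ id) ≈ α⇒ ∘ γ ∘ α⇒

  -- middle-four interchange (A⊗B)⊗(C⊗D) → (A⊗C)⊗(B⊗D), i.e. A ⊗ γ_{B,C} ⊗ D
  -- up to associativity
  σ : ∀ A B C D → Hom ((A ⊗₀ B) ⊗₀ (C ⊗₀ D)) ((A ⊗₀ C) ⊗₀ (B ⊗₀ D))
  σ A B C D = α⇐ ∘ (id {A} ⊗₁ (α⇒ ∘ (γ {B} {C} ⊗₁ id {D}) ∘ α⇐)) ∘ α⇒

  field
    δ : ∀ A → Hom A (A ⊗₀ A)
    ε : ∀ A → Hom A I
    μ : ∀ A → Hom (A ⊗₀ A) A
    η : ∀ A → Hom I A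
    μ-assoc : ∀ {A} → μ A ∘ (μ A ⊗₁ id) ≈ μ A ∘ (id ⊗₁ μ A) ∘ α⇒
    μ-unitˡ : ∀ {A} → μ A ∘ (η A ⊗₁ id) ≈ λ⇒
    μ-unitʳ : ∀ {A} → μ A ∘ (id ⊗₁ η A) ≈ ρ⇒
    μ-comm : ∀ {A} → μ A ∘ γ ≈ μ A
    δ-coassoc : ∀ {A} → α⇒ ∘ (δ A ⊗₁ id) ∘ δ A ≈ (id ⊗₁ δ A) ∘ δ A
    δ-counitˡ : ∀ {A} → (ε A ⊗₁ id) ∘ δ A ≈ λ⇐
    δ-counitʳ : ∀ {A} → (id ⊗₁ ε A) ∘ δ A ≈ ρ⇐
    δ-cocomm : ∀ {A} → γ ∘ δ A ≈ δ A
    δ-μ : ∀ {A} → δ A ∘ μ A ≈ (μ A ⊗₁ μ A) ∘ σ A A A A ∘ (δ A ⊗₁ δ A)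
    δ-η : ∀ {A} → δ A ∘ η A ≈ (η A ⊗₁ η A) ∘ λ⇐
    ε-μ : ∀ {A} → ε A ∘ μ A ≈ λ⇒ ∘ (ε A ⊗₁ ε A)
    ε-η : ∀ {A} → ε A ∘ η A ≈ id

    id• : ∀ A → Hom A A
    id•-idem : ∀ {A} → id• A ∘ id• A ≈ id• A
    δ-id• : ∀ {A} → δ A ∘ id• A ≈ (id• A ⊗₁ η A) ∘ ρ⇐ + (η A ⊗₁ id• A) ∘ λ⇐
    id•-μ : ∀ {A} → id• A ∘ μ A ≈ ρ⇒ ∘ (id• A ⊗₁ ε A) + λ⇒ ∘ (ε A ⊗₁ id• A)
    ε-id• : ∀ {A} → ε A ∘ id• A ≈ 0#
    id•-η : ∀ {A} → id• A ∘ η A ≈ 0#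

    δ-⊗ : ∀ {A B} → δ (A ⊗₀ B) ≈ σ A A B B ∘ (δ A ⊗₁ δ B)
    ε-⊗ : ∀ {A B} → ε (A ⊗₀ B) ≈ λ⇒ ∘ (ε A ⊗₁ ε B)
    ε-I : ε I ≈ id
    μ-⊗ : ∀ {A B} → μ (A ⊗₀ B) ≈ (μ A ⊗₁ μ B) ∘ σ A B A B
    η-⊗ : ∀ {A B} → η (A ⊗₀ B) ≈ (η A ⊗₁ η B) ∘ λ⇐
    η-I : η I ≈ id

  1# : ∀ {X Y} → Hom X Y
  1# {X} {Y} = η Y ∘ ε X

  _*_ : ∀ {X Y} → Hom X Y → Hom X Y → Hom X Y
  _*_ {X} {Y} f g = μ Y ∘ (f ⊗₁ g) ∘ δ X

  Π : ∀ {X Y} → List (Hom X Y) → Hom X Y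
  Π [] = 1#
  Π (f ∷ []) = f
  Π (f ∷ g ∷ fs) = f * Π (g ∷ fs)

  Σ+ : ∀ {X Y} → List (Hom X Y) → Hom X Y
  Σ+ = foldr _+_ 0#

  Pointed : ∀ {A B} → Hom A B → Set e
  Pointed {A} {B} f = id• B ∘ f ≈ f

  CoPointed : ∀ {A B} → Hom A B → Set e
  CoPointed {A} {B} f = f ∘ id• A ≈ f

-- all 2^n ways of splitting a list (enumerating a multiset) into two
-- sub-multisets, one for each function p : {1..n} → {1,2}
splits : ∀ {a} {X : Set a} → List X → List (List X × List X)
splits [] = ([] , []) ∷ []
splits (x ∷ xs) = concatMap (λ { (l , r) → (x ∷ l , r) ∷ (l , x ∷ r) ∷ [] }) (splits xs)

ifEmpty : ∀ {a b} {X : Set a} {Y : Set b} → List X → Y → Y → Y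
ifEmpty [] y z = y
ifEmpty (_ ∷ _) y z = z

-- A pointed f is primitive, δ ∘ f ≈ (f ⊗ 1 + 1 ⊗ f) ∘ δ, and ε ∘ f ≈ 0.  Since δ is a
-- morphism of monoids and of comonoids, δ ∘ f ≈ F ∘ δ and δ ∘ g ≈ G ∘ δ give
-- δ ∘ (f * g) ≈ (F * G) ∘ δ, with the convolution F * G taken in C(A ⊗ A, B ⊗ B), where
-- (a ⊗ b) * (c ⊗ d) ≈ (a * c) ⊗ (b * d).  So (f ⊗ 1 + 1 ⊗ f) * Σ Π f₁ ⊗ Π f₂ is the sum over
-- the splittings of f ∷ fs, and (1a) follows by induction; (1b) holds because
-- ε ∘ (f * g) vanishes as soon as ε ∘ f does.  Part (2) is part (1) in the opposite
-- resource category, where (δ, ε) and (μ, η) trade places and pointed morphisms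
-- become co-pointed ones.
module Submission where

open import Defs
open import Level using (Level)
open import Data.List using (List; []; _∷_; _++_; map; concatMap)
open import Data.List.Relation.Unary.All using (All; []; _∷_)
open import Data.Product using (_×_; _,_; proj₁; proj₂)
open import Relation.Binary using (Setoid)
import Relation.Binary.Reasoning.Setoid as SetoidReasoning

module Properties {o ℓ e : Level} (𝒞 : ResourceCategory o ℓ e) where
  open ResourceCategory 𝒞

  hom-setoid : Obj → Obj → Setoid ℓ e
  hom-setoid A B = record { Carrier = Hom A B ; _≈_ = _≈_ ; isEquivalence = ≈-equiv }

  module _ {A B : Obj} where
    open Setoid (hom-setoid A B) public using (refl; sym; trans)

  module HomReasoning {A B : Obj} = SetoidReasoning (hom-setoid A B)

  private variable
    A B C D A′ B′ C′ D′ : Obj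
    a b c d f g h k s t f′ g′ s′ t′ : Hom A B
    ι κ : Level
    J : Set ι
    K : Set κ

  infixr 4 _⟩∘⟨_ refl⟩∘⟨_ _⟩⊗⟨_ _⟩+⟨_
  infixl 5 _⟩∘⟨refl

  _⟩∘⟨_ : f ≈ f′ → g ≈ g′ → f ∘ g ≈ f′ ∘ g′
  _⟩∘⟨_ = ∘-resp-≈

  refl⟩∘⟨_ : g ≈ g′ → f ∘ g ≈ f ∘ g′
  refl⟩∘⟨ p = refl ⟩∘⟨ p

  _⟩∘⟨refl : f ≈ f′ → f ∘ g ≈ f′ ∘ g
  p ⟩∘⟨refl = p ⟩∘⟨ refl

  _⟩⊗⟨_ : f ≈ f′ → g ≈ g′ → f ⊗₁ g ≈ f′ ⊗₁ g′
  _⟩⊗⟨_ = ⊗-resp-≈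

  _⟩+⟨_ : f ≈ f′ → g ≈ g′ → f + g ≈ f′ + g′
  _⟩+⟨_ = +-resp-≈

  sym-assoc : f ∘ (g ∘ h) ≈ (f ∘ g) ∘ h
  sym-assoc = sym assoc

  pullˡ : f ∘ g ≈ h → f ∘ (g ∘ k) ≈ h ∘ k
  pullˡ p = trans sym-assoc (p ⟩∘⟨refl)

  pullʳ : g ∘ h ≈ k → (f ∘ g) ∘ h ≈ f ∘ k
  pullʳ p = trans assoc (refl⟩∘⟨ p)

  pushˡ : h ≈ f ∘ g → h ∘ k ≈ f ∘ (g ∘ k)
  pushˡ p = sym (pullˡ (sym p))

  cancelˡ : f ∘ g ≈ id → f ∘ (g ∘ h) ≈ h
  cancelˡ p = trans (pullˡ p) identityˡ

  cancelʳ : g ∘ h ≈ id → (f ∘ g) ∘ h ≈ f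
  cancelʳ p = trans (pullʳ p) identityʳ

  glue : t ∘ b ≈ c ∘ t′ → s ∘ a ≈ b ∘ s′ → (t ∘ s) ∘ a ≈ c ∘ (t′ ∘ s′)
  glue p q = trans (pullʳ q) (trans (pullˡ p) assoc)

  id-square : id ∘ f ≈ f ∘ id
  id-square = trans identityˡ (sym identityʳ)

  ⊗-∘ : (f ⊗₁ g) ∘ (h ⊗₁ k) ≈ (f ∘ h) ⊗₁ (g ∘ k)
  ⊗-∘ = sym ⊗-homomorphism

  ⊗-square : f ∘ a ≈ b ∘ f′ → g ∘ c ≈ d ∘ g′ → (f ⊗₁ g) ∘ (a ⊗₁ c) ≈ (b ⊗₁ d) ∘ (f′ ⊗₁ g′)
  ⊗-square p q = trans ⊗-∘ (trans (p ⟩⊗⟨ q) ⊗-homomorphism)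

  serialize₁₂ : f ⊗₁ g ≈ (f ⊗₁ id) ∘ (id ⊗₁ g)
  serialize₁₂ = trans (sym identityʳ ⟩⊗⟨ sym identityˡ) ⊗-homomorphism

  serialize₂₁ : f ⊗₁ g ≈ (id ⊗₁ g) ∘ (f ⊗₁ id)
  serialize₂₁ = trans (sym identityˡ ⟩⊗⟨ sym identityʳ) ⊗-homomorphism

  IsInverse : Hom A B → Hom B A → Set e
  IsInverse f g = g ∘ f ≈ id × f ∘ g ≈ id

  inverse-sym : IsInverse f g → IsInverse g f
  inverse-sym (l , r) = r , l

  inverse-resp-≈ : IsInverse f g → g ≈ g′ → IsInverse f g′
  inverse-resp-≈ (l , r) p = trans (sym p ⟩∘⟨refl) l , trans (refl⟩∘⟨ sym p) r

  inverse-id : IsInverse (id {A}) id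
  inverse-id = identityˡ , identityˡ

  inverse-∘ : IsInverse f f′ → IsInverse g g′ → IsInverse (g ∘ f) (f′ ∘ g′)
  inverse-∘ (fl , fr) (gl , gr) =
    trans (pullʳ (cancelˡ gl)) fl , trans (pullʳ (cancelˡ fr)) gr

  inverse-⊗ : IsInverse f f′ → IsInverse g g′ → IsInverse (f ⊗₁ g) (f′ ⊗₁ g′)
  inverse-⊗ (fl , fr) (gl , gr) =
    trans ⊗-∘ (trans (fl ⟩⊗⟨ gl) ⊗-identity) , trans ⊗-∘ (trans (fr ⟩⊗⟨ gr) ⊗-identity)

  inverse-unique : IsInverse f f′ → IsInverse g g′ → f ≈ g → f′ ≈ g′
  inverse-unique {f = f} {f′ = f′} {g = g} {g′ = g′} (fl , _) (_ , gr) p = begin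
    f′             ≈⟨ identityʳ ⟨
    f′ ∘ id        ≈⟨ refl⟩∘⟨ gr ⟨
    f′ ∘ (g ∘ g′)  ≈⟨ refl⟩∘⟨ (p ⟩∘⟨refl) ⟨
    f′ ∘ (f ∘ g′)  ≈⟨ cancelˡ fl ⟩
    g′             ∎
    where open HomReasoning

  conjugate : ∀ {u : Hom A B} {u⁻¹ v v⁻¹} → IsInverse u u⁻¹ → IsInverse v v⁻¹ →
              v ∘ f ≈ g ∘ u → f ∘ u⁻¹ ≈ v⁻¹ ∘ g
  conjugate (_ , ur) (vl , _) p =
    trans (sym (cancelˡ vl)) (refl⟩∘⟨ trans (pullˡ p) (cancelʳ ur))

  move-isoˡ : IsInverse f g → f ∘ h ≈ k → h ≈ g ∘ k
  move-isoˡ (l , _) p = trans (sym (cancelˡ l)) (refl⟩∘⟨ p)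

  move-isoʳ : IsInverse f g → h ≈ k ∘ f → h ∘ g ≈ k
  move-isoʳ (_ , r) p = trans (p ⟩∘⟨refl) (cancelʳ r)

  +-identityʳ : f + 0# ≈ f
  +-identityʳ = trans +-comm +-identityˡ

  ∘-distrib-+ : f ∘ (g + h) ∘ k ≈ f ∘ g ∘ k + f ∘ h ∘ k
  ∘-distrib-+ = trans (refl⟩∘⟨ ∘-distribʳ-+) ∘-distribˡ-+

  α-inverse : IsInverse (α⇒ {A} {B} {C}) α⇐
  α-inverse = α-isoˡ , α-isoʳ

  λ-inverse : IsInverse (λ⇒ {A}) λ⇐
  λ-inverse = λ-isoˡ , λ-isoʳ

  ρ-inverse : IsInverse (ρ⇒ {A}) ρ⇐
  ρ-inverse = ρ-isoˡ , ρ-isoʳ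

  γ-inverse : IsInverse (γ {A} {B}) γ
  γ-inverse = γ-involutive , γ-involutive

  α⇐-natural : ((f ⊗₁ g) ⊗₁ h) ∘ α⇐ ≈ α⇐ ∘ (f ⊗₁ (g ⊗₁ h))
  α⇐-natural = conjugate α-inverse α-inverse α-natural

  λ⇐-natural : (id ⊗₁ f) ∘ λ⇐ ≈ λ⇐ ∘ f
  λ⇐-natural = conjugate λ-inverse λ-inverse λ-natural

  ρ⇐-natural : (f ⊗₁ id) ∘ ρ⇐ ≈ ρ⇐ ∘ f
  ρ⇐-natural = conjugate ρ-inverse ρ-inverse ρ-natural

  swap₁₂ : ∀ A B C → Hom (A ⊗₀ (B ⊗₀ C)) (B ⊗₀ (A ⊗₀ C))
  swap₁₂ A B C = α⇒ ∘ (γ ⊗₁ id) ∘ α⇐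

  swap₁₂-natural : swap₁₂ A′ B′ C′ ∘ (a ⊗₁ (b ⊗₁ c)) ≈ (b ⊗₁ (a ⊗₁ c)) ∘ swap₁₂ A B C
  swap₁₂-natural = glue α-natural (glue (⊗-square γ-natural id-square) (sym α⇐-natural))

  swap₁₂-inverse : IsInverse (swap₁₂ A B C) (swap₁₂ B A C)
  swap₁₂-inverse = inverse-resp-≈
    (inverse-∘ (inverse-∘ (inverse-sym α-inverse) (inverse-⊗ γ-inverse inverse-id)) α-inverse)
    assoc

  σ-natural : σ A′ B′ C′ D′ ∘ ((a ⊗₁ b) ⊗₁ (c ⊗₁ d)) ≈ ((a ⊗₁ c) ⊗₁ (b ⊗₁ d)) ∘ σ A B C D
  σ-natural = glue (sym α⇐-natural) (glue (⊗-square id-square swap₁₂-natural) α-natural)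

  σ-inverse : IsInverse (σ A B C D) (σ A C B D)
  σ-inverse = inverse-resp-≈
    (inverse-∘ (inverse-∘ α-inverse (inverse-⊗ inverse-id swap₁₂-inverse)) (inverse-sym α-inverse))
    assoc

  Σ+-map-cong : ∀ {F G : J → Hom A B} → (∀ j → F j ≈ G j) → ∀ js → Σ+ (map F js) ≈ Σ+ (map G js)
  Σ+-map-cong p []       = refl
  Σ+-map-cong p (j ∷ js) = p j ⟩+⟨ Σ+-map-cong p js

  Σ+-map-homo : (T : Hom A B → Hom A′ B′) → (∀ {f g} → T (f + g) ≈ T f + T g) → T 0# ≈ 0# →
                ∀ (F : J → Hom A B) js → T (Σ+ (map F js)) ≈ Σ+ (map (λ j → T (F j)) js)
  Σ+-map-homo T T-+ T-0 F []       = T-0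
  Σ+-map-homo T T-+ T-0 F (j ∷ js) = trans T-+ (refl ⟩+⟨ Σ+-map-homo T T-+ T-0 F js)

  Σ+-++ : (F : J → Hom A B) → ∀ js ks → Σ+ (map F (js ++ ks)) ≈ Σ+ (map F js) + Σ+ (map F ks)
  Σ+-++ F []       ks = sym +-identityˡ
  Σ+-++ F (j ∷ js) ks = trans (refl ⟩+⟨ Σ+-++ F js ks) (sym +-assoc)

  Σ+-concatMap : (F : J → Hom A B) (G : K → List J) → ∀ ks →
                 Σ+ (map F (concatMap G ks)) ≈ Σ+ (map (λ k → Σ+ (map F (G k))) ks)
  Σ+-concatMap F G []       = refl
  Σ+-concatMap F G (k ∷ ks) = trans (Σ+-++ F (G k) (concatMap G ks)) (refl ⟩+⟨ Σ+-concatMap F G ks)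

  Σ+-splits-∷ : (Q : List J × List J → Hom A B) → ∀ j js →
                Σ+ (map Q (splits (j ∷ js)))
                  ≈ Σ+ (map (λ s → Q (j ∷ proj₁ s , proj₂ s) + Q (proj₁ s , j ∷ proj₂ s)) (splits js))
  Σ+-splits-∷ Q j js =
    trans (Σ+-concatMap Q _ (splits js)) (Σ+-map-cong (λ _ → refl ⟩+⟨ +-identityʳ) (splits js))

module Convolution {o ℓ e : Level} (𝒞 : ResourceCategory o ℓ e) where
  open ResourceCategory 𝒞
  open Properties 𝒞
  open HomReasoning

  private variable
    X Y : Obj
    f g h : Hom X Y

  δ-μ-⊗ : δ X ∘ μ X ≈ μ (X ⊗₀ X) ∘ (δ X ⊗₁ δ X)
  δ-μ-⊗ = trans δ-μ (trans sym-assoc (sym μ-⊗ ⟩∘⟨refl))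

  δ-δ : δ (X ⊗₀ X) ∘ δ X ≈ (δ X ⊗₁ δ X) ∘ δ X
  δ-δ {X} = begin
    δ (X ⊗₀ X) ∘ δ X                          ≈⟨ δ-⊗ ⟩∘⟨refl ⟩
    (σ X X X X ∘ (δ X ⊗₁ δ X)) ∘ δ X          ≈⟨ trans assoc (pullʳ (pullʳ α-δ⊗δ)) ⟩
    α⇐ ∘ (id ⊗₁ swap₁₂ X X X) ∘ (id ⊗₁ δ₃) ∘ δ X
                                              ≈⟨ refl⟩∘⟨ pullˡ (trans ⊗-∘ (identityˡ ⟩⊗⟨ swap₁₂-δ₃)) ⟩
    α⇐ ∘ (id ⊗₁ δ₃) ∘ δ X                     ≈⟨ move-isoˡ α-inverse α-δ⊗δ ⟨
    (δ X ⊗₁ δ X) ∘ δ X                        ∎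
    where
    δ₃ : Hom X (X ⊗₀ (X ⊗₀ X))
    δ₃ = (id ⊗₁ δ X) ∘ δ X

    α-δ⊗δ : α⇒ ∘ (δ X ⊗₁ δ X) ∘ δ X ≈ (id ⊗₁ δ₃) ∘ δ X
    α-δ⊗δ = begin
      α⇒ ∘ (δ X ⊗₁ δ X) ∘ δ X                        ≈⟨ refl⟩∘⟨ pushˡ δ⊗δ-split ⟩
      α⇒ ∘ ((id ⊗₁ id) ⊗₁ δ X) ∘ (δ X ⊗₁ id) ∘ δ X   ≈⟨ pullˡ α-natural ⟩
      ((id ⊗₁ (id ⊗₁ δ X)) ∘ α⇒) ∘ (δ X ⊗₁ id) ∘ δ X ≈⟨ pullʳ δ-coassoc ⟩
      (id ⊗₁ (id ⊗₁ δ X)) ∘ (id ⊗₁ δ X) ∘ δ X        ≈⟨ pullˡ (trans ⊗-∘ (identityˡ ⟩⊗⟨ refl)) ⟩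
      (id ⊗₁ δ₃) ∘ δ X                               ∎
      where
      δ⊗δ-split : δ X ⊗₁ δ X ≈ ((id ⊗₁ id) ⊗₁ δ X) ∘ (δ X ⊗₁ id)
      δ⊗δ-split = sym (trans ⊗-∘ (trans (⊗-identity ⟩∘⟨refl) identityˡ ⟩⊗⟨ identityʳ))

    swap₁₂-δ₃ : swap₁₂ X X X ∘ δ₃ ≈ δ₃
    swap₁₂-δ₃ = begin
      swap₁₂ X X X ∘ δ₃                                  ≈⟨ refl⟩∘⟨ δ-coassoc ⟨
      (α⇒ ∘ (γ ⊗₁ id) ∘ α⇐) ∘ α⇒ ∘ (δ X ⊗₁ id) ∘ δ X     ≈⟨ pullʳ (pullʳ (cancelˡ α-isoˡ)) ⟩
      α⇒ ∘ (γ ⊗₁ id) ∘ (δ X ⊗₁ id) ∘ δ X                 ≈⟨ refl⟩∘⟨ pullˡ (trans ⊗-∘ (δ-cocomm ⟩⊗⟨ identityˡ)) ⟩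
      α⇒ ∘ (δ X ⊗₁ id) ∘ δ X                             ≈⟨ δ-coassoc ⟩
      δ₃                                                 ∎

  δ-* : ∀ {X Y} {f g : Hom X Y} {F G : Hom (X ⊗₀ X) (Y ⊗₀ Y)} →
        δ Y ∘ f ≈ F ∘ δ X → δ Y ∘ g ≈ G ∘ δ X → δ Y ∘ (f * g) ≈ (F * G) ∘ δ X
  δ-* {X} {Y} {f} {g} {F} {G} δf δg = begin
    δ Y ∘ μ Y ∘ (f ⊗₁ g) ∘ δ X                           ≈⟨ pullˡ δ-μ-⊗ ⟩
    (μ (Y ⊗₀ Y) ∘ (δ Y ⊗₁ δ Y)) ∘ (f ⊗₁ g) ∘ δ X         ≈⟨ pullʳ (pullˡ (⊗-square δf δg)) ⟩
    μ (Y ⊗₀ Y) ∘ ((F ⊗₁ G) ∘ (δ X ⊗₁ δ X)) ∘ δ X        ≈⟨ refl⟩∘⟨ pullʳ (sym δ-δ) ⟩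
    μ (Y ⊗₀ Y) ∘ (F ⊗₁ G) ∘ δ (X ⊗₀ X) ∘ δ X            ≈⟨ trans (refl⟩∘⟨ sym-assoc) sym-assoc ⟩
    (F * G) ∘ δ X                                        ∎

  ε-*-zeroˡ : ∀ {X Y} {f g : Hom X Y} → ε Y ∘ f ≈ 0# → ε Y ∘ (f * g) ≈ 0#
  ε-*-zeroˡ {X} {Y} {f} {g} εf = begin
    ε Y ∘ μ Y ∘ (f ⊗₁ g) ∘ δ X                  ≈⟨ pullˡ ε-μ ⟩
    (λ⇒ ∘ (ε Y ⊗₁ ε Y)) ∘ (f ⊗₁ g) ∘ δ X        ≈⟨ pullʳ (pullˡ ⊗-∘) ⟩
    λ⇒ ∘ ((ε Y ∘ f) ⊗₁ (ε Y ∘ g)) ∘ δ X         ≈⟨ refl⟩∘⟨ (εf ⟩⊗⟨ refl) ⟩∘⟨refl ⟩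
    λ⇒ ∘ (0# ⊗₁ (ε Y ∘ g)) ∘ δ X                ≈⟨ refl⟩∘⟨ trans (⊗-zeroˡ ⟩∘⟨refl) ∘-zeroˡ ⟩
    λ⇒ ∘ 0#                                     ≈⟨ ∘-zeroʳ ⟩
    0#                                          ∎

  ⊗1#∘δ : (f ⊗₁ 1# {X} {Y}) ∘ δ X ≈ (f ⊗₁ η Y) ∘ ρ⇐
  ⊗1#∘δ = trans (pushˡ (trans (sym identityʳ ⟩⊗⟨ refl) ⊗-homomorphism)) (refl⟩∘⟨ δ-counitʳ)

  1#⊗∘δ : (1# {X} {Y} ⊗₁ f) ∘ δ X ≈ (η Y ⊗₁ f) ∘ λ⇐
  1#⊗∘δ = trans (pushˡ (trans (refl ⟩⊗⟨ sym identityʳ) ⊗-homomorphism)) (refl⟩∘⟨ δ-counitˡ)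

  *-identityˡ : ∀ {X Y} {f : Hom X Y} → 1# * f ≈ f
  *-identityˡ {X} {Y} {f} = begin
    μ Y ∘ (1# ⊗₁ f) ∘ δ X             ≈⟨ refl⟩∘⟨ 1#⊗∘δ ⟩
    μ Y ∘ (η Y ⊗₁ f) ∘ λ⇐             ≈⟨ refl⟩∘⟨ pushˡ serialize₁₂ ⟩
    μ Y ∘ (η Y ⊗₁ id) ∘ (id ⊗₁ f) ∘ λ⇐ ≈⟨ pullˡ μ-unitˡ ⟩
    λ⇒ ∘ (id ⊗₁ f) ∘ λ⇐               ≈⟨ pullˡ λ-natural ⟩
    (f ∘ λ⇒) ∘ λ⇐                     ≈⟨ cancelʳ λ-isoʳ ⟩
    f                                 ∎

  *-identityʳ : ∀ {X Y} {f : Hom X Y} → f * 1# ≈ f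
  *-identityʳ {X} {Y} {f} = begin
    μ Y ∘ (f ⊗₁ 1#) ∘ δ X             ≈⟨ refl⟩∘⟨ ⊗1#∘δ ⟩
    μ Y ∘ (f ⊗₁ η Y) ∘ ρ⇐             ≈⟨ refl⟩∘⟨ pushˡ serialize₂₁ ⟩
    μ Y ∘ (id ⊗₁ η Y) ∘ (f ⊗₁ id) ∘ ρ⇐ ≈⟨ pullˡ μ-unitʳ ⟩
    ρ⇒ ∘ (f ⊗₁ id) ∘ ρ⇐               ≈⟨ pullˡ ρ-natural ⟩
    (f ∘ ρ⇒) ∘ ρ⇐                     ≈⟨ cancelʳ ρ-isoʳ ⟩
    f                                 ∎

  *-distribˡ-+ : f * (g + h) ≈ f * g + f * h
  *-distribˡ-+ = trans (refl⟩∘⟨ (⊗-distribˡ-+ ⟩∘⟨refl)) ∘-distrib-+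

  *-distribʳ-+ : (f + g) * h ≈ f * h + g * h
  *-distribʳ-+ = trans (refl⟩∘⟨ (⊗-distribʳ-+ ⟩∘⟨refl)) ∘-distrib-+

  *-zeroʳ : f * 0# ≈ 0#
  *-zeroʳ = trans (refl⟩∘⟨ trans (⊗-zeroʳ ⟩∘⟨refl) ∘-zeroˡ) ∘-zeroʳ

  ⊗-*-interchange : ∀ {a b c d : Hom X Y} → (a ⊗₁ b) * (c ⊗₁ d) ≈ (a * c) ⊗₁ (b * d)
  ⊗-*-interchange {X} {Y} {a} {b} {c} {d} = begin
    μ (Y ⊗₀ Y) ∘ ((a ⊗₁ b) ⊗₁ (c ⊗₁ d)) ∘ δ (X ⊗₀ X)              ≈⟨ μ-⊗ ⟩∘⟨ (refl⟩∘⟨ δ-⊗) ⟩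
    ((μ Y ⊗₁ μ Y) ∘ σ Y Y Y Y) ∘ ((a ⊗₁ b) ⊗₁ (c ⊗₁ d)) ∘ σ X X X X ∘ (δ X ⊗₁ δ X)
                                                                 ≈⟨ pullʳ (pullˡ σ-natural) ⟩
    (μ Y ⊗₁ μ Y) ∘ (((a ⊗₁ c) ⊗₁ (b ⊗₁ d)) ∘ σ X X X X) ∘ σ X X X X ∘ (δ X ⊗₁ δ X)
                                                                 ≈⟨ refl⟩∘⟨ pullʳ (cancelˡ (proj₁ σ-inverse)) ⟩
    (μ Y ⊗₁ μ Y) ∘ ((a ⊗₁ c) ⊗₁ (b ⊗₁ d)) ∘ (δ X ⊗₁ δ X)         ≈⟨ trans (refl⟩∘⟨ ⊗-∘) ⊗-∘ ⟩
    (a * c) ⊗₁ (b * d)                                            ∎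

  pointed⇒primitive : ∀ {X Y} {f : Hom X Y} → Pointed f → δ Y ∘ f ≈ (f ⊗₁ 1# + 1# ⊗₁ f) ∘ δ X
  pointed⇒primitive {X} {Y} {f} pf = begin
    δ Y ∘ f                                                   ≈⟨ refl⟩∘⟨ pf ⟨
    δ Y ∘ id• Y ∘ f                                           ≈⟨ pullˡ δ-id• ⟩
    ((id• Y ⊗₁ η Y) ∘ ρ⇐ + (η Y ⊗₁ id• Y) ∘ λ⇐) ∘ f           ≈⟨ ∘-distribʳ-+ ⟩
    ((id• Y ⊗₁ η Y) ∘ ρ⇐) ∘ f + ((η Y ⊗₁ id• Y) ∘ λ⇐) ∘ f     ≈⟨ left ⟩+⟨ right ⟩
    (f ⊗₁ 1#) ∘ δ X + (1# ⊗₁ f) ∘ δ X                         ≈⟨ ∘-distribʳ-+ ⟨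
    (f ⊗₁ 1# + 1# ⊗₁ f) ∘ δ X                                 ∎
    where
    left : ((id• Y ⊗₁ η Y) ∘ ρ⇐) ∘ f ≈ (f ⊗₁ 1#) ∘ δ X
    left = trans (pullʳ (sym ρ⇐-natural)) (trans (pullˡ (trans ⊗-∘ (pf ⟩⊗⟨ identityʳ))) (sym ⊗1#∘δ))

    right : ((η Y ⊗₁ id• Y) ∘ λ⇐) ∘ f ≈ (1# ⊗₁ f) ∘ δ X
    right = trans (pullʳ (sym λ⇐-natural)) (trans (pullˡ (trans ⊗-∘ (identityʳ ⟩⊗⟨ pf))) (sym 1#⊗∘δ))

  pointed⇒ε-zero : Pointed f → ε Y ∘ f ≈ 0#
  pointed⇒ε-zero pf = trans (refl⟩∘⟨ sym pf) (trans (pullˡ ε-id•) ∘-zeroˡ)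

  δ-1# : ∀ {X Y} → δ Y ∘ 1# {X} ≈ (1# ⊗₁ 1#) ∘ δ X
  δ-1# {X} {Y} = begin
    δ Y ∘ η Y ∘ ε X                   ≈⟨ pullˡ δ-η ⟩
    ((η Y ⊗₁ η Y) ∘ λ⇐) ∘ ε X         ≈⟨ pullʳ (sym λ⇐-natural) ⟩
    (η Y ⊗₁ η Y) ∘ (id ⊗₁ ε X) ∘ λ⇐   ≈⟨ pullˡ (trans ⊗-∘ (identityʳ ⟩⊗⟨ refl)) ⟩
    (η Y ⊗₁ 1#) ∘ λ⇐                  ≈⟨ 1#⊗∘δ ⟨
    (1# ⊗₁ 1#) ∘ δ X                  ∎

  Π-∷ : ∀ (f : Hom X Y) fs → Π (f ∷ fs) ≈ f * Π fs
  Π-∷ f []      = sym *-identityʳ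
  Π-∷ f (_ ∷ _) = refl

  Π⊗Π : List (Hom X Y) × List (Hom X Y) → Hom (X ⊗₀ X) (Y ⊗₀ Y)
  Π⊗Π (fs , gs) = Π fs ⊗₁ Π gs

  Σ-splits : List (Hom X Y) → Hom (X ⊗₀ X) (Y ⊗₀ Y)
  Σ-splits fs = Σ+ (map Π⊗Π (splits fs))

  primitive-*-Σ-splits : ∀ (f : Hom X Y) fs → (f ⊗₁ 1# + 1# ⊗₁ f) * Σ-splits fs ≈ Σ-splits (f ∷ fs)
  primitive-*-Σ-splits f fs = begin
    (f ⊗₁ 1# + 1# ⊗₁ f) * Σ-splits fs
      ≈⟨ Σ+-map-homo ((f ⊗₁ 1# + 1# ⊗₁ f) *_) *-distribˡ-+ *-zeroʳ Π⊗Π (splits fs) ⟩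
    Σ+ (map (λ s → (f ⊗₁ 1# + 1# ⊗₁ f) * Π⊗Π s) (splits fs))
      ≈⟨ Σ+-map-cong term (splits fs) ⟩
    Σ+ (map (λ s → Π⊗Π (f ∷ proj₁ s , proj₂ s) + Π⊗Π (proj₁ s , f ∷ proj₂ s)) (splits fs))
      ≈⟨ Σ+-splits-∷ Π⊗Π f fs ⟨
    Σ-splits (f ∷ fs) ∎
    where
    term : ∀ s → (f ⊗₁ 1# + 1# ⊗₁ f) * Π⊗Π s
                   ≈ Π⊗Π (f ∷ proj₁ s , proj₂ s) + Π⊗Π (proj₁ s , f ∷ proj₂ s)
    term (gs , hs) = begin
      (f ⊗₁ 1# + 1# ⊗₁ f) * (Π gs ⊗₁ Π hs)
        ≈⟨ *-distribʳ-+ ⟩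
      (f ⊗₁ 1#) * (Π gs ⊗₁ Π hs) + (1# ⊗₁ f) * (Π gs ⊗₁ Π hs)
        ≈⟨ ⊗-*-interchange ⟩+⟨ ⊗-*-interchange ⟩
      (f * Π gs) ⊗₁ (1# * Π hs) + (1# * Π gs) ⊗₁ (f * Π hs)
        ≈⟨ (sym (Π-∷ f gs) ⟩⊗⟨ *-identityˡ) ⟩+⟨ (*-identityˡ ⟩⊗⟨ sym (Π-∷ f hs)) ⟩
      Π (f ∷ gs) ⊗₁ Π hs + Π gs ⊗₁ Π (f ∷ hs)
        ∎

  δ-Π : ∀ (fs : List (Hom X Y)) → All Pointed fs → δ Y ∘ Π fs ≈ Σ-splits fs ∘ δ X
  δ-Π []       []       = trans δ-1# (sym +-identityʳ ⟩∘⟨refl)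
  δ-Π (f ∷ fs) (p ∷ ps) = begin
    δ _ ∘ Π (f ∷ fs)                          ≈⟨ refl⟩∘⟨ Π-∷ f fs ⟩
    δ _ ∘ (f * Π fs)                          ≈⟨ δ-* (pointed⇒primitive p) (δ-Π fs ps) ⟩
    ((f ⊗₁ 1# + 1# ⊗₁ f) * Σ-splits fs) ∘ δ _ ≈⟨ primitive-*-Σ-splits f fs ⟩∘⟨refl ⟩
    Σ-splits (f ∷ fs) ∘ δ _                   ∎

  ε-Π : ∀ (fs : List (Hom X Y)) → All Pointed fs → ε Y ∘ Π fs ≈ ifEmpty fs 1# 0#
  ε-Π []       []      = trans (pullˡ ε-η) (trans identityˡ (sym (trans (η-I ⟩∘⟨refl) identityˡ)))
  ε-Π (f ∷ fs) (p ∷ _) = trans (refl⟩∘⟨ Π-∷ f fs) (ε-*-zeroˡ (pointed⇒ε-zero p))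

op : ∀ {o ℓ e} → ResourceCategory o ℓ e → ResourceCategory o ℓ e
op 𝒞 = record
  { Obj = Obj
  ; Hom = λ A B → Hom B A
  ; _≈_ = _≈_
  ; ≈-equiv = ≈-equiv
  ; id = id
  ; _∘_ = λ f g → g ∘ f
  ; ∘-resp-≈ = λ p q → q ⟩∘⟨ p
  ; assoc = sym-assoc
  ; identityˡ = identityʳ
  ; identityʳ = identityˡ
  ; _+_ = _+_
  ; 0# = 0#
  ; +-resp-≈ = +-resp-≈
  ; +-assoc = +-assoc
  ; +-comm = +-comm
  ; +-identityˡ = +-identityˡ
  ; I = I
  ; _⊗₀_ = _⊗₀_
  ; _⊗₁_ = _⊗₁_
  ; ⊗-resp-≈ = ⊗-resp-≈
  ; ⊗-identity = ⊗-identity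
  ; ⊗-homomorphism = ⊗-homomorphism
  ; ∘-distribˡ-+ = ∘-distribʳ-+
  ; ∘-distribʳ-+ = ∘-distribˡ-+
  ; ∘-zeroˡ = ∘-zeroʳ
  ; ∘-zeroʳ = ∘-zeroˡ
  ; ⊗-distribˡ-+ = ⊗-distribˡ-+
  ; ⊗-distribʳ-+ = ⊗-distribʳ-+
  ; ⊗-zeroˡ = ⊗-zeroˡ
  ; ⊗-zeroʳ = ⊗-zeroʳ
  ; α⇒ = α⇐
  ; α⇐ = α⇒
  ; λ⇒ = λ⇐
  ; λ⇐ = λ⇒
  ; ρ⇒ = ρ⇐
  ; ρ⇐ = ρ⇒
  ; γ = γ
  ; α-isoˡ = α-isoˡ
  ; α-isoʳ = α-isoʳ
  ; λ-isoˡ = λ-isoˡ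
  ; λ-isoʳ = λ-isoʳ
  ; ρ-isoˡ = ρ-isoˡ
  ; ρ-isoʳ = ρ-isoʳ
  ; γ-involutive = γ-involutive
  ; α-natural = α⇐-natural
  ; λ-natural = λ⇐-natural
  ; ρ-natural = ρ⇐-natural
  ; γ-natural = sym γ-natural
  ; pentagon = inverse-unique
      (inverse-∘ (inverse-∘ (inverse-⊗ α-inverse inverse-id) α-inverse) (inverse-⊗ inverse-id α-inverse))
      (inverse-∘ α-inverse α-inverse)
      pentagon
  ; triangle = inverse-unique
      (inverse-∘ α-inverse (inverse-⊗ inverse-id λ-inverse))
      (inverse-⊗ ρ-inverse inverse-id)
      triangle
  ; hexagon = inverse-unique
      (inverse-∘ (inverse-∘ (inverse-⊗ γ-inverse inverse-id) α-inverse) (inverse-⊗ inverse-id γ-inverse))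
      (inverse-∘ (inverse-∘ α-inverse γ-inverse) α-inverse)
      hexagon
  ; δ = μ
  ; ε = η
  ; μ = δ
  ; η = ε
  ; μ-assoc = trans (move-isoˡ α-inverse δ-coassoc) sym-assoc
  ; μ-unitˡ = δ-counitˡ
  ; μ-unitʳ = δ-counitʳ
  ; μ-comm = δ-cocomm
  ; δ-coassoc = move-isoʳ α-inverse (trans μ-assoc sym-assoc)
  ; δ-counitˡ = μ-unitˡ
  ; δ-counitʳ = μ-unitʳ
  ; δ-cocomm = μ-comm
  ; δ-μ = trans δ-μ (trans sym-assoc ((refl⟩∘⟨ sym σ-reassoc) ⟩∘⟨refl))
  ; δ-η = ε-μ
  ; ε-μ = δ-η
  ; ε-η = ε-η
  ; id• = id•
  ; id•-idem = id•-idem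
  ; δ-id• = id•-μ
  ; id•-μ = δ-id•
  ; ε-id• = id•-η
  ; id•-η = ε-id•
  ; δ-⊗ = trans μ-⊗ (refl⟩∘⟨ sym σ-reassoc)
  ; ε-⊗ = η-⊗
  ; ε-I = η-I
  ; μ-⊗ = trans δ-⊗ (sym σ-reassoc ⟩∘⟨refl)
  ; η-⊗ = ε-⊗
  ; η-I = ε-I
  }
  where
  open ResourceCategory 𝒞
  open Properties 𝒞

  -- the left-hand side is σ A B C D computed in op 𝒞
  σ-reassoc : ∀ {A B C D} →
              (α⇐ ∘ (id ⊗₁ ((α⇒ ∘ (γ ⊗₁ id)) ∘ α⇐))) ∘ α⇒ ≈ σ A C B D
  σ-reassoc = trans assoc (refl⟩∘⟨ (refl ⟩⊗⟨ assoc) ⟩∘⟨refl)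

module Duality {o ℓ e : Level} (𝒞 : ResourceCategory o ℓ e) where
  open ResourceCategory 𝒞
  open Properties 𝒞
  open Convolution 𝒞 using (Σ-splits)
  private
    module 𝒞ᵒᵖ = ResourceCategory (op 𝒞)
    module Convolutionᵒᵖ = Convolution (op 𝒞)

  -- Convolution in op 𝒞 brackets μ ∘ (f ⊗₁ g) ∘ δ the other way round.
  Π-op : ∀ {X Y} (fs : List (Hom X Y)) → 𝒞ᵒᵖ.Π fs ≈ Π fs
  Π-op []           = refl
  Π-op (f ∷ [])     = refl
  Π-op (f ∷ g ∷ fs) = trans assoc (refl⟩∘⟨ (refl ⟩⊗⟨ Π-op (g ∷ fs)) ⟩∘⟨refl)

  Σ-splits-op : ∀ {X Y} (fs : List (Hom X Y)) → Convolutionᵒᵖ.Σ-splits fs ≈ Σ-splits fs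
  Σ-splits-op fs = Σ+-map-cong (λ (gs , hs) → Π-op gs ⟩⊗⟨ Π-op hs) (splits fs)

  Π-μ : ∀ {X Y} (fs : List (Hom X Y)) → All CoPointed fs → Π fs ∘ μ X ≈ μ Y ∘ Σ-splits fs
  Π-μ fs ps =
    trans (sym (Π-op fs) ⟩∘⟨refl) (trans (Convolutionᵒᵖ.δ-Π fs ps) (refl⟩∘⟨ Σ-splits-op fs))

  Π-η : ∀ {X Y} (fs : List (Hom X Y)) → All CoPointed fs → Π fs ∘ η X ≈ ifEmpty fs 1# 0#
  Π-η fs ps = trans (sym (Π-op fs) ⟩∘⟨refl) (Convolutionᵒᵖ.ε-Π fs ps)

lemma6p4 : ∀ {o ℓ e : Level} (𝒞 : ResourceCategory o ℓ e) →
    let open ResourceCategory 𝒞 in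
    (A B : Obj) →
    (∀ (fs : List (Hom A B)) → All Pointed fs →
        (δ B ∘ Π fs ≈ Σ+ (map (λ { (f₁ , f₂) → Π f₁ ⊗₁ Π f₂ }) (splits fs)) ∘ δ A)
      × (ε B ∘ Π fs ≈ ifEmpty fs 1# 0#))
    × (∀ (fs : List (Hom A B)) → All CoPointed fs →
        (Π fs ∘ μ A ≈ μ B ∘ Σ+ (map (λ { (f₁ , f₂) → Π f₁ ⊗₁ Π f₂ }) (splits fs)))
      × (Π fs ∘ η A ≈ ifEmpty fs 1# 0#))
lemma6p4 𝒞 A B =
  (λ fs ps → δ-Π fs ps , ε-Π fs ps) , (λ fs ps → Π-μ fs ps , Π-η fs ps)
  where
  open Convolution 𝒞
  open Duality 𝒞
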